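{- Let $\alpha,\beta\in\mathbb{N}\cup\{0\}$, $1_F\in\mathbb{N}$, and let $F\in\mathcal{T}_\lambda(\alpha,\beta)$ be the corresponding sequence. Let $(b_1,\dots,b_k)$ be a composition of $n\in\mathbb{N}$ into $k$ positive parts. Then $$n_F=\Big(\sum_{s=1}^k b_s\Big)_F=\sum_{s=1}^k \alpha^{b_{s+1}+\cdots+b_k}\,\beta^{b_1+\cdots+b_{s-1}}\,(b_s)_F .$$
   Context: $\mathcal{T}_\lambda(\alpha,\beta)$ denotes the family of natural-number-valued sequences $F=(n_F)_{n\ge1}$ given by $n_F=[x^n]\mathcal{F}(x)$, where $$\mathcal{F}(x)=1_F\cdot\frac{x}{(1-\alpha x)(1-\beta x)},$$ with $\alpha,\beta\in\mathbb{N}\cup\{0\}$ and $1_F\in\mathbb{N}$. Explicitly, $n_F=1_F\,n\,\alpha^{n-1}$ if $\alpha=\beta$, and $n_F=\frac{1_F}{\alpha-\beta}(\alpha^n-\beta^n)$ if $\alpha\ne\beta$. Empty sums in the exponents are $0$. -}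

module Defs where

open import Data.Nat using (ℕ; zero; suc; _+_; _*_; _^_; _∸_; _<ᵇ_)
open import Data.Bool using (if_then_else_)
open import Data.Fin using (Fin; toℕ)
open import Data.Vec using (Vec; lookup; sum; tabulate)

Σ< : ℕ → (ℕ → ℕ) → ℕ
Σ< zero    f = 0
Σ< (suc m) f = Σ< m f + f m

-- [x^n] of x / ((1 - α x)(1 - β x)) = Σ_{i+j=n-1} α^i β^j  (and 0 for n = 0)
coeffBase : ℕ → ℕ → ℕ → ℕ
coeffBase α β zero    = 0
coeffBase α β (suc m) = Σ< (suc m) (λ i → α ^ i * β ^ (m ∸ i))

-- n_F = [x^n] 𝓕(x),  𝓕(x) = 1_F · x / ((1-αx)(1-βx)),  F ∈ 𝒯_λ(α,β)
seqF : (α β oneF : ℕ) → ℕ → ℕ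
seqF α β oneF n = oneF * coeffBase α β n

-- For b = (b_1,…,b_k) stored 0-indexed as a Vec:
-- partsBefore b s = sum of b_j with j < s ;  partsAfter b s = sum of b_j with j > s
partsBefore : ∀ {k} → Vec ℕ k → Fin k → ℕ
partsBefore b s = sum (tabulate (λ j → if toℕ j <ᵇ toℕ s then lookup b j else 0))

partsAfter : ∀ {k} → Vec ℕ k → Fin k → ℕ
partsAfter b s = sum (tabulate (λ j → if toℕ s <ᵇ toℕ j then lookup b j else 0))

-- The coefficients c(n) = Σ_{i+j=n-1} αⁱ βʲ satisfy c(n+1) = β c(n) + αⁿ, and
-- induction on a turns this into c(a + b) = αᵇ c(a) + βᵃ c(b).  Splitting off the
-- first part b₁ of a composition and recursing on the rest gives the formula, the
-- factor β^{b₁} being absorbed into the "parts before" exponents of later terms.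
module Submission where

open import Defs
open import Data.Nat using (ℕ; zero; suc; _+_; _*_; _^_; _∸_; _≤_; _<_)
open import Data.Nat.Properties
  using (m<n⇒m<1+n; ≤-refl; ≤-pred; *-zeroʳ; *-distribˡ-+; +-∸-assoc; n∸n≡0;
         *-identityʳ; ^-distribˡ-+-*)
open import Data.Nat.Tactic.RingSolver using (solve-∀)
open import Data.Fin using (Fin)
open import Data.Vec using (Vec; []; _∷_; lookup; sum; tabulate)
open import Data.Vec.Properties using (tabulate∘lookup; tabulate-cong)
open import Data.Product using (_×_; _,_)
open import Relation.Binary.PropositionalEquality
open ≡-Reasoning

Σ<-cong : ∀ m {f g : ℕ → ℕ} → (∀ i → i < m → f i ≡ g i) → Σ< m f ≡ Σ< m g
Σ<-cong zero    f≡g = refl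
Σ<-cong (suc m) f≡g =
  cong₂ _+_ (Σ<-cong m (λ i i<m → f≡g i (m<n⇒m<1+n i<m))) (f≡g m ≤-refl)

Σ<-*ˡ : ∀ m c (f : ℕ → ℕ) → Σ< m (λ i → c * f i) ≡ c * Σ< m f
Σ<-*ˡ zero    c f = sym (*-zeroʳ c)
Σ<-*ˡ (suc m) c f =
  trans (cong (_+ c * f m) (Σ<-*ˡ m c f)) (sym (*-distribˡ-+ c (Σ< m f) (f m)))

sum-tabulate-*ˡ : ∀ {k} c (f : Fin k → ℕ) →
  c * sum (tabulate f) ≡ sum (tabulate (λ s → c * f s))
sum-tabulate-*ˡ {zero}  c f = *-zeroʳ c
sum-tabulate-*ˡ {suc k} c f =
  trans (*-distribˡ-+ c _ _) (cong (c * f Fin.zero +_) (sum-tabulate-*ˡ c (λ s → f (Fin.suc s))))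

sum-tabulate-zero : ∀ k → sum (tabulate {n = k} (λ _ → 0)) ≡ 0
sum-tabulate-zero zero    = refl
sum-tabulate-zero (suc k) = sum-tabulate-zero k

coeffBase-suc : ∀ α β m → coeffBase α β (suc m) ≡ β * coeffBase α β m + α ^ m
coeffBase-suc α β zero    = cong (_+ 1) (sym (*-zeroʳ β))
coeffBase-suc α β (suc m) = cong₂ _+_ shiftβ lastTerm
  where
  swap : ∀ a b c → a * (b * c) ≡ b * (a * c)
  swap = solve-∀

  shiftβ : Σ< (suc m) (λ i → α ^ i * β ^ (suc m ∸ i))
         ≡ β * Σ< (suc m) (λ i → α ^ i * β ^ (m ∸ i))
  shiftβ = begin
    Σ< (suc m) (λ i → α ^ i * β ^ (suc m ∸ i))
      ≡⟨ Σ<-cong (suc m) (λ i i≤m → cong (λ e → α ^ i * β ^ e) (+-∸-assoc 1 (≤-pred i≤m))) ⟩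
    Σ< (suc m) (λ i → α ^ i * (β * β ^ (m ∸ i)))
      ≡⟨ Σ<-cong (suc m) (λ i _ → swap (α ^ i) β (β ^ (m ∸ i))) ⟩
    Σ< (suc m) (λ i → β * (α ^ i * β ^ (m ∸ i)))
      ≡⟨ Σ<-*ˡ (suc m) β _ ⟩
    β * Σ< (suc m) (λ i → α ^ i * β ^ (m ∸ i)) ∎

  lastTerm : α ^ suc m * β ^ (suc m ∸ suc m) ≡ α ^ suc m
  lastTerm = trans (cong (λ e → α ^ suc m * β ^ e) (n∸n≡0 (suc m))) (*-identityʳ _)

coeffBase-+ : ∀ α β a b →
  coeffBase α β (a + b) ≡ α ^ b * coeffBase α β a + β ^ a * coeffBase α β b
coeffBase-+ α β zero    b = unit (α ^ b) (coeffBase α β b)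
  where
  unit : ∀ x c → c ≡ x * 0 + 1 * c
  unit = solve-∀
coeffBase-+ α β (suc a) b = begin
  coeffBase α β (suc (a + b))
    ≡⟨ coeffBase-suc α β (a + b) ⟩
  β * coeffBase α β (a + b) + α ^ (a + b)
    ≡⟨ cong₂ (λ u v → β * u + v) (coeffBase-+ α β a b) (^-distribˡ-+-* α a b) ⟩
  β * (α ^ b * coeffBase α β a + β ^ a * coeffBase α β b) + α ^ a * α ^ b
    ≡⟨ regroup β (α ^ b) (coeffBase α β a) (β ^ a) (coeffBase α β b) (α ^ a) ⟩
  α ^ b * (β * coeffBase α β a + α ^ a) + β * β ^ a * coeffBase α β b
    ≡⟨ cong (λ u → α ^ b * u + β * β ^ a * coeffBase α β b) (coeffBase-suc α β a) ⟨
  α ^ b * coeffBase α β (suc a) + β ^ suc a * coeffBase α β b ∎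
  where
  regroup : ∀ B X C Y D Z → B * (X * C + Y * D) + Z * X ≡ X * (B * C + Z) + B * Y * D
  regroup = solve-∀

seqF-+ : ∀ α β oneF a b →
  seqF α β oneF (a + b) ≡ α ^ b * seqF α β oneF a + β ^ a * seqF α β oneF b
seqF-+ α β oneF a b =
  trans (cong (oneF *_) (coeffBase-+ α β a b))
        (distribute oneF (α ^ b) (coeffBase α β a) (β ^ a) (coeffBase α β b))
  where
  distribute : ∀ o x c y d → o * (x * c + y * d) ≡ x * (o * c) + y * (o * d)
  distribute = solve-∀

partsBefore-head : ∀ {k} x (b : Vec ℕ k) → partsBefore (x ∷ b) Fin.zero ≡ 0
partsBefore-head {k} x b = sum-tabulate-zero k

partsAfter-head : ∀ {k} x (b : Vec ℕ k) → partsAfter (x ∷ b) Fin.zero ≡ sum b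
partsAfter-head x b = cong sum (tabulate∘lookup b)

seqF-sum : ∀ α β oneF {k} (b : Vec ℕ k) →
  seqF α β oneF (sum b)
    ≡ sum (tabulate (λ (s : Fin k) →
        α ^ partsAfter b s * β ^ partsBefore b s * seqF α β oneF (lookup b s)))
seqF-sum α β oneF []      = *-zeroʳ oneF
seqF-sum α β oneF (x ∷ b) = begin
  F (x + sum b)
    ≡⟨ seqF-+ α β oneF x (sum b) ⟩
  α ^ sum b * F x + β ^ x * F (sum b)
    ≡⟨ cong₂ _+_ headTerm (cong (β ^ x *_) (seqF-sum α β oneF b)) ⟩
  term (x ∷ b) Fin.zero + β ^ x * sum (tabulate (term b))
    ≡⟨ cong (term (x ∷ b) Fin.zero +_) (sum-tabulate-*ˡ (β ^ x) (term b)) ⟩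
  term (x ∷ b) Fin.zero + sum (tabulate (λ s → β ^ x * term b s))
    ≡⟨ cong (term (x ∷ b) Fin.zero +_) (cong sum (tabulate-cong tailTerm)) ⟩
  term (x ∷ b) Fin.zero + sum (tabulate (λ s → term (x ∷ b) (Fin.suc s))) ∎
  where
  F : ℕ → ℕ
  F = seqF α β oneF

  term : ∀ {k} → Vec ℕ k → Fin k → ℕ
  term c s = α ^ partsAfter c s * β ^ partsBefore c s * F (lookup c s)

  headTerm : α ^ sum b * F x ≡ term (x ∷ b) Fin.zero
  headTerm = begin
    α ^ sum b * F x          ≡⟨ cong (_* F x) (*-identityʳ (α ^ sum b)) ⟨
    α ^ sum b * β ^ 0 * F x  ≡⟨ cong₂ (λ u v → α ^ u * β ^ v * F x)
                                  (partsAfter-head x b) (partsBefore-head x b) ⟨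
    term (x ∷ b) Fin.zero    ∎

  -- partsAfter (x ∷ b) (suc s) and partsBefore (x ∷ b) (suc s) reduce to
  -- partsAfter b s and x + partsBefore b s, since suc m <ᵇ suc n = m <ᵇ n.
  tailTerm : ∀ s → β ^ x * term b s ≡ term (x ∷ b) (Fin.suc s)
  tailTerm s = begin
    β ^ x * (A * β ^ P * S)  ≡⟨ rearrange (β ^ x) A (β ^ P) S ⟩
    A * (β ^ x * β ^ P) * S  ≡⟨ cong (λ u → A * u * S) (^-distribˡ-+-* β x P) ⟨
    A * β ^ (x + P) * S      ∎
    where
    A P S : ℕ
    A = α ^ partsAfter b s
    P = partsBefore b s
    S = F (lookup b s)
    rearrange : ∀ y a p t → y * (a * p * t) ≡ a * (y * p) * t
    rearrange = solve-∀

mainTheorem5 : (α β oneF : ℕ) → 1 ≤ oneF →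
    (n k : ℕ) → 1 ≤ n → (b : Vec ℕ k) → (∀ s → 1 ≤ lookup b s) → sum b ≡ n →
    (seqF α β oneF n ≡ seqF α β oneF (sum b))
    × (seqF α β oneF (sum b)
       ≡ sum (tabulate (λ (s : Fin k) →
           α ^ partsAfter b s * β ^ partsBefore b s * seqF α β oneF (lookup b s))))
mainTheorem5 α β oneF _ n k _ b _ sum-b≡n =
  cong (seqF α β oneF) (sym sum-b≡n) , seqF-sum α β oneF b
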